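{- Let $n\in\mathbb N$, let $T:\mathbb R^2\to\mathbb R^2$, $T(x,y)=(x,-y)$, and let $c$ be a metric-like cost function on $\mathbb R^2$. For $\pi=(n_1,\dots,n_k)\in\mathscr P_1(n)$: (1) all $n_i$ are odd if and only if $T(\hat\delta_\pi)=\hat\delta_\pi$; (2) all $n_i$ are odd if and only if $C(\hat\delta_\pi,T(\hat\delta_\pi))=0$.
   Context: $\mathscr P_1(n)$ is the set of tuples $(n_1,\dots,n_k)$ of integers with $n\ge n_1\ge\dots\ge n_k\ge1$ and $\sum n_i=n$. Define $\hat\delta_\pi:=\sum_{i=1}^k\sum_{\alpha=1}^{n_i}\delta_{(i,\lfloor -n_i/2\rfloor+\alpha)}$ (unit point masses in $\mathbb R^2$), and $T(\hat\delta_\pi)$ is its push-forward under $T$. A measurable cost $c$ is metric-like if $c\ge0$ with $c(x,y)=0$ iff $x=y$, $c$ symmetric, and $c$ satisfies the triangle inequality. For measures $\mu^-,\mu^+$ which are sums of $n$ unit point masses at distinct points, $C(\mu^-,\mu^+)$ is the minimum of $\sum_{z\in\operatorname{spt}\mu^- }c(z,g(z))$ over bijections $g:\operatorname{spt}\mu^-\to\operatorname{spt}\mu^+$. -}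

module Defs where

open import Level using (Level; suc; _⊔_)
open import Data.Nat as ℕ using (ℕ; zero)
open import Data.Nat.Properties using ()
open import Data.Integer as ℤ using (ℤ; +_; -_; _/ℕ_)
open import Data.Product using (_×_; _,_; Σ-syntax)
open import Data.List using (List; []; _∷_; map; zipWith; upTo; foldr)
open import Data.Nat.ListAction using (sum)
open import Data.List.Relation.Unary.All using (All)
open import Data.List.Relation.Binary.Permutation.Propositional using (_↭_)
open import Relation.Binary.PropositionalEquality using (_≡_)
open import Function.Bundles using (_⇔_)

data Decreasing : List ℕ → Set where
  []   : Decreasing []
  [_]  : ∀ a → Decreasing (a ∷ [])
  _∷_  : ∀ {a b l} → b ℕ.≤ a → Decreasing (b ∷ l) → Decreasing (a ∷ b ∷ l)

record P₁ (n : ℕ) : Set where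
  field
    parts    : List ℕ
    bounded  : All (ℕ._≤ n) parts
    decr     : Decreasing parts
    positive : All (1 ℕ.≤_) parts
    total    : sum parts ≡ n
open P₁ public

AllOdd : List ℕ → Set
AllOdd = All (λ m → m ℕ.% 2 ≡ 1)

-- Points of ℤ² ⊂ ℝ² (all measures involved are supported on ℤ²)

Point : Set
Point = ℤ × ℤ

T : Point → Point
T (x , y) = (x , - y)

-- ⌊ -m/2 ⌋  (_/ℕ_ is floor division for a positive divisor)
floorNegHalf : ℕ → ℤ
floorNegHalf m = (- (+ m)) /ℕ 2

row : ℕ → ℕ → List Point
row i m = map (λ a → (+ i , floorNegHalf m ℤ.+ + (ℕ.suc a))) (upTo m)

rowsFrom : ℕ → List ℕ → List Point
rowsFrom i []       = []
rowsFrom i (m ∷ ms) = row i m Data.List.++ rowsFrom (ℕ.suc i) ms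

-- A sum of unit point masses is represented by the list of its atoms;
-- equality of measures is equality of multisets of atoms (_↭_).
-- δ̂_π = Σ_{i=1}^k Σ_{α=1}^{nᵢ} δ_(i, ⌊-nᵢ/2⌋+α)
δ̂ : List ℕ → List Point
δ̂ ns = rowsFrom 1 ns

push : (Point → Point) → List Point → List Point
push f = map f

-- Codomain of costs: an ordered commutative monoid (ℝ≥0-style values,
-- ℝ with +, 0, ≤ is an instance).

record OrderedCommMonoid (a ℓ : Level) : Set (suc (a ⊔ ℓ)) where
  field
    Carrier   : Set a
    0#        : Carrier
    _+_       : Carrier → Carrier → Carrier
    _≤_       : Carrier → Carrier → Set ℓ
    +-assoc   : ∀ x y z → (x + y) + z ≡ x + (y + z)
    +-comm    : ∀ x y → x + y ≡ y + x
    +-identityˡ : ∀ x → 0# + x ≡ x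
    ≤-refl    : ∀ {x} → x ≤ x
    ≤-trans   : ∀ {x y z} → x ≤ y → y ≤ z → x ≤ z
    ≤-antisym : ∀ {x y} → x ≤ y → y ≤ x → x ≡ y
    +-mono-≤  : ∀ {x y u v} → x ≤ y → u ≤ v → (x + u) ≤ (y + v)

module _ {a ℓ} (V : OrderedCommMonoid a ℓ) where
  open OrderedCommMonoid V

  record MetricLike (c : Point → Point → Carrier) : Set (a ⊔ ℓ) where
    field
      nonneg    : ∀ x y → 0# ≤ c x y
      zero-iff  : ∀ x y → (c x y ≡ 0#) ⇔ (x ≡ y)
      symmetric : ∀ x y → c x y ≡ c y x
      triangle  : ∀ x y z → c x z ≤ (c x y + c y z)

  Σᵥ : List Carrier → Carrier
  Σᵥ = foldr _+_ 0#

  -- cost of the bijection g sending the k-th atom of μ⁻ to the k-th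
  -- atom of ys, where ys is a rearrangement of the atoms of μ⁺
  costOf : (Point → Point → Carrier) → List Point → List Point → Carrier
  costOf c xs ys = Σᵥ (zipWith c xs ys)

  -- m = C(μ⁻,μ⁺): m is the minimum, over all bijections
  -- spt μ⁻ → spt μ⁺ (i.e. over all rearrangements ys of μ⁺),
  -- of Σ_z c(z, g z).
  record IsOptimalCost (c : Point → Point → Carrier)
                       (μ⁻ μ⁺ : List Point) (m : Carrier) : Set (a ⊔ ℓ) where
    field
      attained : Σ[ ys ∈ List Point ] (μ⁺ ↭ ys × costOf c μ⁻ ys ≡ m)
      minimal  : ∀ ys → μ⁺ ↭ ys → m ≤ costOf c μ⁻ ys

-- Row i of δ̂_π carries the heights ⌊-m/2⌋ + 1, …, ⌊-m/2⌋ + m (m = nᵢ), and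
-- 2⌊-m/2⌋ = -(m + m mod 2). So for odd m the reflection y ↦ -y reverses the row,
-- while for even m it sends the top height m/2 to ⌊-m/2⌋, just below the row;
-- as T keeps the abscissa, δ̂_π is T-invariant iff every row is, iff all nᵢ are odd.
-- For (2): costs are nonnegative and vanish only on the diagonal, so the optimal
-- cost is 0 iff some rearrangement of T(δ̂_π) is matched to δ̂_π pointwise, i.e.
-- iff T(δ̂_π) is a rearrangement of δ̂_π.

module Submission where

open import Defs
open import Data.Nat using (ℕ)
open import Data.Product using (_×_)
open import Data.List.Relation.Binary.Permutation.Propositional using (_↭_; ↭-refl)
open import Relation.Binary.PropositionalEquality using (_≡_)
open import Function.Bundles using (_⇔_)

open import Algebra.Bundles using (AbelianGroup)
open import Data.Empty using (⊥-elim)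
open import Data.Integer as ℤ using (ℤ; +_; -_; 0ℤ)
import Data.Integer.Properties as ℤ
open import Data.Integer.Tactic.RingSolver using (solve-∀)
open import Data.List using (List; []; _∷_; _++_; map; reverse; upTo; applyUpTo; applyDownFrom; length)
import Data.List.Properties as List
open import Data.List.Membership.Propositional using (_∈_; _∉_)
open import Data.List.Membership.Propositional.Properties using (∈-map⁺; ∈-map⁻; ∈-++⁺ˡ; ∈-++⁺ʳ; ∈-++⁻; ∈-upTo⁺)
open import Data.List.Relation.Binary.Permutation.Propositional.Properties using (∈-resp-↭; ↭-length; ↭-reverse; ++⁺)
open import Data.List.Relation.Unary.All as All using (All; []; _∷_)
open import Data.List.Relation.Unary.All.Properties using (all-upTo) renaming (map⁺ to All-map⁺; ++⁺ to All-++⁺)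
open import Data.Nat as ℕ using (suc; _∸_; _%_; _/_; s≤s)
import Data.Nat.Properties as ℕ
open import Data.Nat.DivMod using (m≡m%n+[m/n]*n; m%n<n)
open import Data.Product using (_,_; proj₁; proj₂)
open import Data.Sum using (_⊎_; inj₁; inj₂)
open import Function.Bundles using (mk⇔; Equivalence)
import Function.Properties.Equivalence as ⇔
open import Relation.Binary.PropositionalEquality using (refl; sym; trans; cong; cong₂; subst; subst₂; _≢_; module ≡-Reasoning)
open import Relation.Nullary using (¬_)

open import Algebra.Properties.Group (AbelianGroup.group ℤ.+-0-abelianGroup) using (∙-cancelˡ)

open ≡-Reasoning

m*2≡m+m : ∀ m → m ℕ.* 2 ≡ m ℕ.+ m
m*2≡m+m m = trans (ℕ.*-comm m 2) (cong (m ℕ.+_) (ℕ.+-identityʳ m))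

m%2≡0⊎m%2≡1 : ∀ m → m % 2 ≡ 0 ⊎ m % 2 ≡ 1
m%2≡0⊎m%2≡1 m with m % 2 | m%n<n m 2
... | 0           | _            = inj₁ refl
... | 1           | _            = inj₂ refl
... | suc (suc _) | s≤s (s≤s ())

floorNegHalf+floorNegHalf : ∀ m → floorNegHalf m ℤ.+ floorNegHalf m ≡ - + (m ℕ.+ m % 2)
floorNegHalf+floorNegHalf ℕ.zero = refl
floorNegHalf+floorNegHalf m@(suc _) with m % 2 | m%n<n m 2 | m≡m%n+[m/n]*n m 2
... | 0 | _ | m≡2k = begin
  - + (m / 2) ℤ.+ - + (m / 2)  ≡⟨ ℤ.neg-distrib-+ (+ (m / 2)) (+ (m / 2)) ⟨
  - + (m / 2 ℕ.+ m / 2)        ≡⟨ cong (λ k → - + k) (trans (sym (m*2≡m+m (m / 2))) (sym m≡2k)) ⟩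
  - + m                        ≡⟨ cong (λ k → - + k) (ℕ.+-identityʳ m) ⟨
  - + (m ℕ.+ 0)                ∎
... | 1 | _ | m≡1+2k = cong (λ k → - + k) (begin
  suc (suc (m / 2 ℕ.+ m / 2))  ≡⟨ cong suc (trans m≡1+2k (cong suc (m*2≡m+m (m / 2)))) ⟨
  suc m                        ≡⟨ ℕ.+-comm 1 m ⟩
  m ℕ.+ 1                      ∎)
... | suc (suc _) | s≤s (s≤s ()) | _

neg-+-reflect : ∀ f a b → f ℤ.+ f ≡ - (a ℤ.+ b) → - (f ℤ.+ a) ≡ f ℤ.+ b
neg-+-reflect f a b f+f≡-[a+b] = begin
  - (f ℤ.+ a)                                  ≡⟨ rearrange f a b ⟩
  (f ℤ.+ b) ℤ.- (f ℤ.+ f ℤ.+ (a ℤ.+ b))        ≡⟨ cong (λ x → (f ℤ.+ b) ℤ.- (x ℤ.+ (a ℤ.+ b))) f+f≡-[a+b] ⟩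
  (f ℤ.+ b) ℤ.- (- (a ℤ.+ b) ℤ.+ (a ℤ.+ b))    ≡⟨ cong (λ x → (f ℤ.+ b) ℤ.- x) (ℤ.+-inverseˡ (a ℤ.+ b)) ⟩
  (f ℤ.+ b) ℤ.- 0ℤ                             ≡⟨ ℤ.+-identityʳ (f ℤ.+ b) ⟩
  f ℤ.+ b                                      ∎
  where
  rearrange : ∀ f a b → - (f ℤ.+ a) ≡ (f ℤ.+ b) ℤ.- (f ℤ.+ f ℤ.+ (a ℤ.+ b))
  rearrange = solve-∀

rowPoint : ℕ → ℕ → ℕ → Point
rowPoint i m a = (+ i , floorNegHalf m ℤ.+ + suc a)

T-rowPoint : ∀ i m a b → floorNegHalf m ℤ.+ floorNegHalf m ≡ - + (suc a ℕ.+ b) →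
             T (rowPoint i m a) ≡ (+ i , floorNegHalf m ℤ.+ + b)
T-rowPoint i m a b h = cong (+ i ,_) (neg-+-reflect (floorNegHalf m) (+ suc a) (+ b) h)

applyDownFrom≡applyUpTo-reflect : ∀ {A : Set} (f : ℕ → A) n →
                                  applyDownFrom f n ≡ applyUpTo (λ a → f (n ∸ suc a)) n
applyDownFrom≡applyUpTo-reflect f ℕ.zero    = refl
applyDownFrom≡applyUpTo-reflect f (suc n) = cong (f n ∷_) (applyDownFrom≡applyUpTo-reflect f n)

reverse-map-upTo : ∀ {A : Set} (f : ℕ → A) n →
                   reverse (map f (upTo n)) ≡ map (λ a → f (n ∸ suc a)) (upTo n)
reverse-map-upTo f n = begin
  reverse (map f (upTo n))                ≡⟨ cong reverse (List.map-applyUpTo (λ a → a) f n) ⟩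
  reverse (applyUpTo f n)                 ≡⟨ List.reverse-applyUpTo f n ⟩
  applyDownFrom f n                       ≡⟨ applyDownFrom≡applyUpTo-reflect f n ⟩
  applyUpTo (λ a → f (n ∸ suc a)) n       ≡⟨ List.map-applyUpTo (λ a → a) _ n ⟨
  map (λ a → f (n ∸ suc a)) (upTo n)      ∎

push-T-row-odd : ∀ i m → m % 2 ≡ 1 → push T (row i m) ≡ reverse (row i m)
push-T-row-odd i m m-odd = begin
  map T (map (rowPoint i m) (upTo m))               ≡⟨ List.map-∘ (upTo m) ⟨
  map (λ a → T (rowPoint i m a)) (upTo m)           ≡⟨ List.map-cong-local (All.map T-reflect (all-upTo m)) ⟩
  map (λ a → rowPoint i m (m ∸ suc a)) (upTo m)     ≡⟨ reverse-map-upTo (rowPoint i m) m ⟨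
  reverse (row i m)                                 ∎
  where
  T-reflect : ∀ {a} → a ℕ.< m → T (rowPoint i m a) ≡ rowPoint i m (m ∸ suc a)
  T-reflect {a} a<m = T-rowPoint i m a (suc (m ∸ suc a)) (begin
    floorNegHalf m ℤ.+ floorNegHalf m        ≡⟨ floorNegHalf+floorNegHalf m ⟩
    - + (m ℕ.+ m % 2)                        ≡⟨ cong (λ k → - + k) m+m%2≡[1+a]+[1+b] ⟩
    - + (suc a ℕ.+ suc (m ∸ suc a))          ∎)
    where
    m+m%2≡[1+a]+[1+b] : m ℕ.+ m % 2 ≡ suc a ℕ.+ suc (m ∸ suc a)
    m+m%2≡[1+a]+[1+b] = begin
      m ℕ.+ m % 2                  ≡⟨ cong (m ℕ.+_) m-odd ⟩
      m ℕ.+ 1                      ≡⟨ ℕ.+-comm m 1 ⟩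
      suc m                        ≡⟨ cong suc (ℕ.m∸n+n≡m a<m) ⟨
      suc (m ∸ suc a ℕ.+ suc a)    ≡⟨ cong suc (ℕ.+-comm (m ∸ suc a) (suc a)) ⟩
      suc (suc a ℕ.+ (m ∸ suc a))  ≡⟨ ℕ.+-suc (suc a) (m ∸ suc a) ⟨
      suc a ℕ.+ suc (m ∸ suc a)    ∎

push-T-rowsFrom↭ : ∀ i ms → AllOdd ms → push T (rowsFrom i ms) ↭ rowsFrom i ms
push-T-rowsFrom↭ i []       []             = ↭-refl
push-T-rowsFrom↭ i (m ∷ ms) (m-odd ∷ odds)
  rewrite List.map-++ T (row i m) (rowsFrom (suc i) ms) | push-T-row-odd i m m-odd
  = ++⁺ (↭-reverse (row i m)) (push-T-rowsFrom↭ (suc i) ms odds)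

Closed : {A : Set} → (A → A) → List A → Set
Closed f xs = ∀ {x} → x ∈ xs → f x ∈ xs

map-↭⇒Closed : ∀ {A : Set} {f : A → A} {xs} → map f xs ↭ xs → Closed f xs
map-↭⇒Closed {f = f} fxs↭xs x∈xs = ∈-resp-↭ fxs↭xs (∈-map⁺ f x∈xs)

module _ {A : Set} {P : A → Set} {x : A} where

  ∈-++-All⁻ˡ : ∀ xs {ys} → All P ys → ¬ P x → x ∈ xs ++ ys → x ∈ xs
  ∈-++-All⁻ˡ xs Pys ¬Px x∈ with ∈-++⁻ xs x∈
  ... | inj₁ x∈xs = x∈xs
  ... | inj₂ x∈ys = ⊥-elim (¬Px (All.lookup Pys x∈ys))

  ∈-++-All⁻ʳ : ∀ {xs} ys → All P xs → ¬ P x → x ∈ xs ++ ys → x ∈ ys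
  ∈-++-All⁻ʳ {xs} ys Pxs ¬Px x∈ with ∈-++⁻ xs x∈
  ... | inj₁ x∈xs = ⊥-elim (¬Px (All.lookup Pxs x∈xs))
  ... | inj₂ x∈ys = x∈ys

proj₁-T : ∀ q → proj₁ (T q) ≡ proj₁ q
proj₁-T (x , y) = refl

row-abscissa : ∀ i m → All (λ q → proj₁ q ≡ + i) (row i m)
row-abscissa i m = All-map⁺ (All.universal (λ _ → refl) (upTo m))

rowsFrom-abscissa : ∀ {i j} ms → i ℕ.< j → All (λ q → proj₁ q ≢ + i) (rowsFrom j ms)
rowsFrom-abscissa []       i<j = []
rowsFrom-abscissa {i} {j} (m ∷ ms) i<j =
  All-++⁺ (All.map (λ x≡j x≡i → ℕ.<⇒≢ i<j (ℤ.+-injective (trans (sym x≡i) x≡j))) (row-abscissa j m))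
          (rowsFrom-abscissa ms (ℕ.m<n⇒m<1+n i<j))

Closed-rowsFrom⇒Closed-row : ∀ i m ms → Closed T (rowsFrom i (m ∷ ms)) → Closed T (row i m)
Closed-rowsFrom⇒Closed-row i m ms closed {q} q∈ =
  ∈-++-All⁻ˡ (row i m) (rowsFrom-abscissa ms (ℕ.n<1+n i))
    (λ Tq≢i → Tq≢i (trans (proj₁-T q) (All.lookup (row-abscissa i m) q∈)))
    (closed (∈-++⁺ˡ q∈))

Closed-rowsFrom⇒Closed-tail : ∀ i m ms → Closed T (rowsFrom i (m ∷ ms)) → Closed T (rowsFrom (suc i) ms)
Closed-rowsFrom⇒Closed-tail i m ms closed {q} q∈ =
  ∈-++-All⁻ʳ (rowsFrom (suc i) ms) (row-abscissa i m)
    (λ Tq≡i → All.lookup (rowsFrom-abscissa ms (ℕ.n<1+n i)) q∈ (trans (sym (proj₁-T q)) Tq≡i))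
    (closed (∈-++⁺ʳ (row i m) q∈))

Closed-row⇒odd : ∀ i m → 1 ℕ.≤ m → Closed T (row i m) → m % 2 ≡ 1
Closed-row⇒odd i m@(suc k) _ closed with m%2≡0⊎m%2≡1 m
... | inj₂ m-odd  = m-odd
... | inj₁ m-even = ⊥-elim (T-top∉row (closed top∈row))
  where
  F : ℤ
  F = floorNegHalf m

  top∈row : rowPoint i m k ∈ row i m
  top∈row = ∈-map⁺ (rowPoint i m) (∈-upTo⁺ (ℕ.n<1+n k))

  T-top : T (rowPoint i m k) ≡ (+ i , F ℤ.+ 0ℤ)
  T-top = T-rowPoint i m k 0 (trans (floorNegHalf+floorNegHalf m) (cong (λ r → - + (m ℕ.+ r)) m-even))

  T-top∉row : T (rowPoint i m k) ∉ row i m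
  T-top∉row T-top∈row with ∈-map⁻ (rowPoint i m) T-top∈row
  ... | a , _ , T-top≡ = ℕ.0≢1+n (ℤ.+-injective (∙-cancelˡ F 0ℤ (+ suc a) (cong proj₂ (trans (sym T-top) T-top≡))))

Closed-rowsFrom⇒AllOdd : ∀ i ms → All (1 ℕ.≤_) ms → Closed T (rowsFrom i ms) → AllOdd ms
Closed-rowsFrom⇒AllOdd i []       []            _      = []
Closed-rowsFrom⇒AllOdd i (m ∷ ms) (1≤m ∷ 1≤ms) closed =
  Closed-row⇒odd i m 1≤m (Closed-rowsFrom⇒Closed-row i m ms closed)
  ∷ Closed-rowsFrom⇒AllOdd (suc i) ms 1≤ms (Closed-rowsFrom⇒Closed-tail i m ms closed)

AllOdd⇔push-T-δ̂↭δ̂ : ∀ ms → All (1 ℕ.≤_) ms → AllOdd ms ⇔ (push T (δ̂ ms) ↭ δ̂ ms)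
AllOdd⇔push-T-δ̂↭δ̂ ms 1≤ms = mk⇔ (push-T-rowsFrom↭ 1 ms)
  (λ T-invariant → Closed-rowsFrom⇒AllOdd 1 ms 1≤ms (map-↭⇒Closed T-invariant))

module _ {a ℓ} (V : OrderedCommMonoid a ℓ) where
  open OrderedCommMonoid V

  +-identityʳ : ∀ x → x + 0# ≡ x
  +-identityʳ x = trans (+-comm x 0#) (+-identityˡ x)

  x+y≡0⇒x≡0 : ∀ {x y} → 0# ≤ x → 0# ≤ y → x + y ≡ 0# → x ≡ 0#
  x+y≡0⇒x≡0 {x} {y} 0≤x 0≤y x+y≡0 = ≤-antisym x≤0 0≤x
    where
    x≤0 : x ≤ 0#
    x≤0 = subst₂ _≤_ (+-identityʳ x) x+y≡0 (+-mono-≤ (≤-refl {x}) 0≤y)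

  x+y≡0⇒y≡0 : ∀ {x y} → 0# ≤ x → 0# ≤ y → x + y ≡ 0# → y ≡ 0#
  x+y≡0⇒y≡0 {x} {y} 0≤x 0≤y x+y≡0 = x+y≡0⇒x≡0 0≤y 0≤x (trans (+-comm y x) x+y≡0)

  module _ {c : Point → Point → Carrier} (metric : MetricLike V c) where
    open MetricLike metric

    costOf-nonneg : ∀ xs ys → 0# ≤ costOf V c xs ys
    costOf-nonneg []       _        = ≤-refl
    costOf-nonneg (_ ∷ _)  []       = ≤-refl
    costOf-nonneg (x ∷ xs) (y ∷ ys) =
      subst (_≤ (c x y + costOf V c xs ys)) (+-identityʳ 0#) (+-mono-≤ (nonneg x y) (costOf-nonneg xs ys))

    costOf-self : ∀ xs → costOf V c xs xs ≡ 0#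
    costOf-self []       = refl
    costOf-self (x ∷ xs) = begin
      c x x + costOf V c xs xs  ≡⟨ cong₂ _+_ (Equivalence.from (zero-iff x x) refl) (costOf-self xs) ⟩
      0# + 0#                   ≡⟨ +-identityˡ 0# ⟩
      0#                        ∎

    costOf≡0⇒≡ : ∀ xs ys → length xs ≡ length ys → costOf V c xs ys ≡ 0# → xs ≡ ys
    costOf≡0⇒≡ []       []       _   _    = refl
    costOf≡0⇒≡ (x ∷ xs) (y ∷ ys) len cost≡0 = cong₂ _∷_
      (Equivalence.to (zero-iff x y) (x+y≡0⇒x≡0 (nonneg x y) (costOf-nonneg xs ys) cost≡0))
      (costOf≡0⇒≡ xs ys (ℕ.suc-injective len) (x+y≡0⇒y≡0 (nonneg x y) (costOf-nonneg xs ys) cost≡0))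

    ↭⇔optimalCost≡0 : ∀ {μ ν m} → length μ ≡ length ν → IsOptimalCost V c μ ν m → (ν ↭ μ) ⇔ (m ≡ 0#)
    ↭⇔optimalCost≡0 {μ} {ν} {m} len optimal = mk⇔ ↭⇒m≡0 m≡0⇒↭
      where
      open IsOptimalCost optimal

      ↭⇒m≡0 : ν ↭ μ → m ≡ 0#
      ↭⇒m≡0 ν↭μ with attained
      ... | ys , _ , cost≡m =
        ≤-antisym (subst (m ≤_) (costOf-self μ) (minimal μ ν↭μ)) (subst (0# ≤_) cost≡m (costOf-nonneg μ ys))

      m≡0⇒↭ : m ≡ 0# → ν ↭ μ
      m≡0⇒↭ m≡0 with attained
      ... | ys , ν↭ys , cost≡m = subst (ν ↭_) (sym μ≡ys) ν↭ys
        where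
        μ≡ys : μ ≡ ys
        μ≡ys = costOf≡0⇒≡ μ ys (trans len (↭-length ν↭ys)) (trans cost≡m m≡0)

proposition4p7 : ∀ {a ℓ} (V : OrderedCommMonoid a ℓ)
    (c : Point → Point → OrderedCommMonoid.Carrier V) → MetricLike V c →
    (n : ℕ) (π : P₁ n) →
    (AllOdd (parts π) ⇔ (push T (δ̂ (parts π)) ↭ δ̂ (parts π)))
    × (∀ m → IsOptimalCost V c (δ̂ (parts π)) (push T (δ̂ (parts π))) m →
         (AllOdd (parts π) ⇔ (m ≡ OrderedCommMonoid.0# V)))
proposition4p7 V c metric n π = odd⇔T-invariant , λ m optimal →
  ⇔.trans odd⇔T-invariant (↭⇔optimalCost≡0 V metric (sym (List.length-map T δ)) optimal)
  where
  δ : List Point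
  δ = δ̂ (parts π)

  odd⇔T-invariant : AllOdd (parts π) ⇔ (push T δ ↭ δ)
  odd⇔T-invariant = AllOdd⇔push-T-δ̂↭δ̂ (parts π) (positive π)
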